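{- Let $n\ge 3$ and let $C_n=x_0x_1\dots x_{n-1}$ be the cycle of order $n$ (subscripts modulo $n$). Let $f$ be an irredundant broadcast on $C_n$ of maximum cost $I\!R_b(C_n)$. If $H_f(x_i)=\emptyset$ for some vertex $x_i$, then $H_f(x_{i-1})\neq\emptyset$ and $H_f(x_{i+1})\neq\emptyset$.
   Context: For a graph $G=(V,E)$, a broadcast is a function $f:V\to\{0,\dots,\operatorname{diam}(G)\}$ with $f(v)\le e_G(v)$ (eccentricity) for all $v$. Let $V^+_f=\{v: f(v)>0\}$ and $H_f(u)=\{v\in V^+_f: d_G(u,v)\le f(v)\}$ (the broadcast vertices that $u$ hears). For $v\in V^+_f$, $PN_f(v)=\{u\in V: H_f(u)=\{v\}\}$, and $PB_f(v)$ is $\{v\}$ if $f(v)=1$ and $PN_f(v)=\{v\}$, and otherwise $PB_f(v)=\{u\in PN_f(v): d_G(u,v)=f(v)\}$. The cost is $\sigma(f)=\sum_v f(v)$. $f$ is irredundant if $PB_f(v)\ne\emptyset$ for every $v\in V^+_f$; $I\!R_b(G)$ is the maximum cost of an irredundant broadcast on $G$. -}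

module Defs where

open import Data.Nat using (ℕ; zero; suc; _+_; _∸_; _≤_; _<_; pred; NonZero)
open import Data.Nat.DivMod using (_mod_)
open import Data.Fin using (Fin; toℕ)
open import Data.List using (List; map; allFin)
open import Data.Nat.ListAction using (sum)
open import Data.Product using (Σ; ∃; _×_)
open import Data.Sum using (_⊎_)
open import Relation.Binary.PropositionalEquality using (_≡_)
open import Relation.Nullary using (¬_)

record Graph (n : ℕ) : Set₁ where
  field
    Adj : Fin n → Fin n → Set

open Graph public

data Within {n : ℕ} (G : Graph n) : ℕ → Fin n → Fin n → Set where
  here : ∀ {k u} → Within G k u u
  step : ∀ {k u w v} → Adj G u w → Within G k w v → Within G (suc k) u v

DistLe : ∀ {n} → Graph n → Fin n → Fin n → ℕ → Set
DistLe G u v k = Within G k u v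

DistEq : ∀ {n} → Graph n → Fin n → Fin n → ℕ → Set
DistEq G u v k = DistLe G u v k × (∀ j → j < k → ¬ DistLe G u v j)

LeEcc : ∀ {n} → Graph n → Fin n → ℕ → Set
LeEcc G v k = ∃ λ u → ∀ j → j < k → ¬ DistLe G v u j

IsBroadcast : ∀ {n} → Graph n → (Fin n → ℕ) → Set
IsBroadcast G f = ∀ v → LeEcc G v (f v)

Hears : ∀ {n} → Graph n → (Fin n → ℕ) → Fin n → Fin n → Set
Hears G f u v = (0 < f v) × DistLe G u v (f v)

PrivNbr : ∀ {n} → Graph n → (Fin n → ℕ) → Fin n → Fin n → Set
PrivNbr G f v u = Hears G f u v × (∀ w → Hears G f u w → w ≡ v)

-- PB_f(v) ≠ ∅ , following the definition:
--   PB_f(v) = {v}                          if f(v)=1 and PN_f(v) = {v},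
--   PB_f(v) = {u ∈ PN_f(v) : d(u,v)=f(v)}  otherwise.
PBNonempty : ∀ {n} → Graph n → (Fin n → ℕ) → Fin n → Set
PBNonempty G f v =
  (f v ≡ 1 × (∀ u → (PrivNbr G f v u → u ≡ v) × (u ≡ v → PrivNbr G f v u)))
  ⊎ (∃ λ u → PrivNbr G f v u × DistEq G u v (f v))

Irredundant : ∀ {n} → Graph n → (Fin n → ℕ) → Set
Irredundant G f = IsBroadcast G f × (∀ v → 0 < f v → PBNonempty G f v)

cost : ∀ {n} → (Fin n → ℕ) → ℕ
cost {n} f = sum (map f (allFin n))

IsIRbBroadcast : ∀ {n} → Graph n → (Fin n → ℕ) → Set
IsIRbBroadcast G f = Irredundant G f × (∀ g → Irredundant G g → cost g ≤ cost f)

HearsNothing : ∀ {n} → Graph n → (Fin n → ℕ) → Fin n → Set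
HearsNothing G f u = ∀ v → ¬ Hears G f u v

cycSuc : (n : ℕ) .{{_ : NonZero n}} → Fin n → Fin n
cycSuc n i = (toℕ i + 1) mod n

cycPred : (n : ℕ) .{{_ : NonZero n}} → Fin n → Fin n
cycPred n i = (toℕ i + (n ∸ 1)) mod n

Cycle : (n : ℕ) .{{_ : NonZero n}} → Graph n
Cycle n = record { Adj = λ i j → (j ≡ cycSuc n i) ⊎ (i ≡ cycSuc n j) }

-- Suppose two adjacent vertices a and a + 1 hear nothing, and write n = K + 3. Number the
-- vertices so that a and a + 1 sit at positions K + 1 and K + 2. Every ball of f then lies in the
-- path 0 … K, where it is the interval [ρ u − f u, ρ u + f u], and irredundance gives it a private
-- boundary point: an endpoint, or the centre when f u = 1. Charging to u the f u points from its
-- centre towards that private point, the point itself excluded, gives pairwise disjoint sets strictly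
-- inside (0, K), so σ(f) ≤ pred K. But C_n has irredundant broadcasts of larger cost (two adjacent
-- vertices of strength ⌈K/2⌉; a single vertex of strength 1 when n = 3), contradicting maximality.
module Submission where

open import Defs
open import Data.Nat using (ℕ; zero; suc; _+_; _*_; _∸_; _≤_; _<_; z≤n; s≤s; pred; NonZero; >-nonZero; >-nonZero⁻¹; _%_; _<?_; ⌊_/2⌋; ⌈_/2⌉)
open import Data.Nat.Properties
open import Data.Nat.DivMod
open import Data.Fin using (Fin; toℕ; fromℕ<; splitAt; _↑ˡ_; _↑ʳ_)
open import Data.Fin.Properties using (toℕ-injective; toℕ-fromℕ<; toℕ<n; toℕ≤n; splitAt⁻¹-↑ˡ; splitAt⁻¹-↑ʳ; injective⇒≤) renaming (suc-injective to Fin-suc-injective)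
open import Data.List using (tabulate)
open import Data.List.Properties using (map-tabulate)
open import Data.Nat.ListAction using (sum)
open import Data.Product using (_×_; _,_; ∃; ∃₂; proj₁; proj₂)
open import Data.Sum using (_⊎_; inj₁; inj₂; [_,_]′; swap)
open import Data.Empty using (⊥-elim)
open import Function using (_∘_)
open import Function.Definitions using (Injective)
open import Relation.Binary.PropositionalEquality
open import Relation.Nullary using (¬_; yes; no)

module _ {L : ℕ} where

  concatMaps : ∀ {m} (f : Fin m → ℕ) → (∀ u → Fin (f u) → Fin L) → Fin (sum (tabulate f)) → Fin L
  concatMaps {suc m} f ι i = [ ι Fin.zero , concatMaps (f ∘ Fin.suc) (ι ∘ Fin.suc) ]′ (splitAt (f Fin.zero) i)

  concatMaps-image : ∀ {m} (f : Fin m → ℕ) (ι : ∀ u → Fin (f u) → Fin L) i →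
    ∃₂ λ u s → concatMaps f ι i ≡ ι u s
  concatMaps-image {suc m} f ι i with splitAt (f Fin.zero) i
  ... | inj₁ s = Fin.zero , s , refl
  ... | inj₂ i′ with concatMaps-image (f ∘ Fin.suc) (ι ∘ Fin.suc) i′
  ...   | u , s , eq = Fin.suc u , s , eq

  private
    head∉tail : ∀ {m} (f : Fin (suc m) → ℕ) (ι : ∀ u → Fin (f u) → Fin L) →
      (∀ {u v s t} → ι u s ≡ ι v t → u ≡ v) →
      ∀ s i → ι Fin.zero s ≢ concatMaps (f ∘ Fin.suc) (ι ∘ Fin.suc) i
    head∉tail f ι disj s i eq with concatMaps-image (f ∘ Fin.suc) (ι ∘ Fin.suc) i
    ... | _ , _ , eq′ with () ← disj (trans eq eq′)

  concatMaps-injective : ∀ {m} (f : Fin m → ℕ) (ι : ∀ u → Fin (f u) → Fin L) →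
    (∀ u → Injective _≡_ _≡_ (ι u)) → (∀ {u v s t} → ι u s ≡ ι v t → u ≡ v) →
    Injective _≡_ _≡_ (concatMaps f ι)
  concatMaps-injective {suc m} f ι inj disj {i} {j} eq
    with splitAt (f Fin.zero) i in split-i | splitAt (f Fin.zero) j in split-j
  ... | inj₁ s | inj₁ t = begin
    i                    ≡⟨ splitAt⁻¹-↑ˡ split-i ⟨
    s ↑ˡ _               ≡⟨ cong (_↑ˡ _) (inj Fin.zero eq) ⟩
    t ↑ˡ _               ≡⟨ splitAt⁻¹-↑ˡ split-j ⟩
    j                    ∎
    where open ≡-Reasoning
  ... | inj₁ s | inj₂ j′ = ⊥-elim (head∉tail f ι disj s j′ eq)
  ... | inj₂ i′ | inj₁ t = ⊥-elim (head∉tail f ι disj t i′ (sym eq))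
  ... | inj₂ i′ | inj₂ j′ = begin
    i                    ≡⟨ splitAt⁻¹-↑ʳ split-i ⟨
    f Fin.zero ↑ʳ i′     ≡⟨ cong (f Fin.zero ↑ʳ_) (concatMaps-injective (f ∘ Fin.suc) (ι ∘ Fin.suc) (inj ∘ Fin.suc) (Fin-suc-injective ∘ disj) eq) ⟩
    f Fin.zero ↑ʳ j′     ≡⟨ splitAt⁻¹-↑ʳ split-j ⟩
    j                    ∎
    where open ≡-Reasoning

sum-≤-of-disjoint-injections : ∀ {m L} (f : Fin m → ℕ) (ι : ∀ u → Fin (f u) → Fin L) →
  (∀ u → Injective _≡_ _≡_ (ι u)) → (∀ {u v s t} → ι u s ≡ ι v t → u ≡ v) →
  sum (tabulate f) ≤ L
sum-≤-of-disjoint-injections f ι inj disj = injective⇒≤ (concatMaps-injective f ι inj disj)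

Fin-positive : ∀ {k} → Fin k → 0 < k
Fin-positive t = ≤-<-trans z≤n (toℕ<n t)

module Intervals {m : ℕ} (c r : Fin m → ℕ) where

  lo hi : Fin m → ℕ
  lo u = c u ∸ r u
  hi u = c u + r u

  Covers : Fin m → ℕ → Set
  Covers u p = 0 < r u × lo u ≤ p × p ≤ hi u

  Private : ℕ → Fin m → Set
  Private p u = ∀ w → Covers w p → w ≡ u

  data PrivateBoundary (u : Fin m) : Set where
    centre : r u ≡ 1 → Private (c u) u → PrivateBoundary u
    left   : Private (lo u) u → PrivateBoundary u
    right  : Private (hi u) u → PrivateBoundary u

  left-private-unique : ∀ {u v p} → Private (lo u) u → Private (lo v) v →
                        Covers u p → Covers v p → u ≡ v
  left-private-unique {u} {v} pu pv (ru , lu , uh) (rv , lv , vh) with ≤-total (lo u) (lo v)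
  ... | inj₁ lu≤lv = pv u (ru , lu≤lv , ≤-trans lv uh)
  ... | inj₂ lv≤lu = sym (pu v (rv , lv≤lu , ≤-trans lu vh))

  right-private-unique : ∀ {u v p} → Private (hi u) u → Private (hi v) v →
                         Covers u p → Covers v p → u ≡ v
  right-private-unique {u} {v} pu pv (ru , lu , uh) (rv , lv , vh) with ≤-total (hi u) (hi v)
  ... | inj₁ hu≤hv = sym (pu v (rv , ≤-trans lv uh , hu≤hv))
  ... | inj₂ hv≤hu = pv u (ru , ≤-trans lu vh , hv≤hu)

  module _ (r≤c : ∀ u → 0 < r u → r u ≤ c u) where

    lo+r≡c : ∀ {u} → 0 < r u → lo u + r u ≡ c u
    lo+r≡c {u} ru = m∸n+n≡m (r≤c u ru)

    lo+hi≡c+c : ∀ {u} → 0 < r u → lo u + hi u ≡ c u + c u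
    lo+hi≡c+c {u} ru = begin
      lo u + (c u + r u)   ≡⟨ cong (lo u +_) (+-comm (c u) (r u)) ⟩
      lo u + (r u + c u)   ≡⟨ +-assoc (lo u) (r u) (c u) ⟨
      lo u + r u + c u     ≡⟨ cong (_+ c u) (lo+r≡c ru) ⟩
      c u + c u            ∎
      where open ≡-Reasoning

    -- If neither covers the other's private point, both endpoints of u lie left of those of v.
    left-right-private-unique : ∀ {u v p} → Private (lo u) u → Private (hi v) v →
                                Covers u p → Covers v p → c v ≤ c u → u ≡ v
    left-right-private-unique {u} {v} pu pv (ru , lu , uh) (rv , lv , vh) cv≤cu
      with ≤-<-connex (lo v) (lo u) | ≤-<-connex (hi v) (hi u)
    ... | inj₁ lv≤lu | _          = sym (pu v (rv , lv≤lu , ≤-trans lu vh))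
    ... | inj₂ _     | inj₁ hv≤hu = pv u (ru , ≤-trans lu vh , hv≤hu)
    ... | inj₂ lu<lv | inj₂ hu<hv = ⊥-elim (<⇒≱ (subst₂ _<_ (lo+hi≡c+c ru) (lo+hi≡c+c rv) (+-mono-< lu<lv hu<hv))
                                                (+-mono-≤ cv≤cu cv≤cu))

    charge : ∀ u → PrivateBoundary u → Fin (r u) → ℕ
    charge u (centre _ _) t = c u
    charge u (left _)     t = suc (lo u + toℕ t)
    charge u (right _)    t = c u + toℕ t

    charge-left≤c : ∀ {u} → 0 < r u → (t : Fin (r u)) → suc (lo u + toℕ t) ≤ c u
    charge-left≤c {u} ru t = subst (suc (lo u + toℕ t) ≤_) (lo+r≡c ru) (+-monoʳ-< (lo u) (toℕ<n t))

    charge-covered : ∀ u b t → Covers u (charge u b t)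
    charge-covered u (centre _ _) t = Fin-positive t , m∸n≤m (c u) (r u) , m≤m+n (c u) (r u)
    charge-covered u (left _)     t = Fin-positive t , ≤-trans (m≤m+n (lo u) (toℕ t)) (n≤1+n _) ,
                                      ≤-trans (charge-left≤c (Fin-positive t) t) (m≤m+n (c u) (r u))
    charge-covered u (right _)    t = Fin-positive t , ≤-trans (m∸n≤m (c u) (r u)) (m≤m+n (c u) (toℕ t)) ,
                                      +-monoʳ-≤ (c u) (<⇒≤ (toℕ<n t))

    charge-positive : ∀ u b t → 0 < charge u b t
    charge-positive u (centre _ _) t = ≤-trans (Fin-positive t) (r≤c u (Fin-positive t))
    charge-positive u (left _)     t = s≤s z≤n
    charge-positive u (right _)    t = ≤-trans (≤-trans (Fin-positive t) (r≤c u (Fin-positive t))) (m≤m+n (c u) (toℕ t))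

    charge<hi : ∀ u b t → charge u b t < hi u
    charge<hi u (centre _ _) t = m<m+n (c u) (Fin-positive t)
    charge<hi u (left _)     t = ≤-<-trans (charge-left≤c (Fin-positive t) t) (m<m+n (c u) (Fin-positive t))
    charge<hi u (right _)    t = +-monoʳ-< (c u) (toℕ<n t)

    charge-injective : ∀ u b → Injective _≡_ _≡_ (charge u b)
    charge-injective u (centre r≡1 _) {s} {t} _ = toℕ-injective (trans (below-1 s) (sym (below-1 t)))
      where
      below-1 : (t : Fin (r u)) → toℕ t ≡ 0
      below-1 t = n<1⇒n≡0 (subst (toℕ t <_) r≡1 (toℕ<n t))
    charge-injective u (left _)  eq = toℕ-injective (+-cancelˡ-≡ (lo u) _ _ (suc-injective eq))
    charge-injective u (right _) eq = toℕ-injective (+-cancelˡ-≡ (c u) _ _ eq)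

    charge-disjoint : ∀ {u v} b b′ s t → charge u b s ≡ charge v b′ t → u ≡ v
    charge-disjoint {u} {v} (centre _ pu) b′ s t eq = sym (pu v (subst (Covers v) (sym eq) (charge-covered v b′ t)))
    charge-disjoint {u} {v} b (centre _ pv) s t eq = pv u (subst (Covers u) eq (charge-covered u b s))
    charge-disjoint {u} {v} (left pu) (left pv) s t eq =
      left-private-unique pu pv (charge-covered u (left pu) s) (subst (Covers v) (sym eq) (charge-covered v (left pv) t))
    charge-disjoint {u} {v} (right pu) (right pv) s t eq =
      right-private-unique pu pv (charge-covered u (right pu) s) (subst (Covers v) (sym eq) (charge-covered v (right pv) t))
    charge-disjoint {u} {v} (left pu) (right pv) s t eq =
      left-right-private-unique pu pv (charge-covered u (left pu) s) (subst (Covers v) (sym eq) (charge-covered v (right pv) t))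
        (≤-trans (m≤m+n (c v) (toℕ t)) (≤-trans (≤-reflexive (sym eq)) (charge-left≤c (Fin-positive s) s)))
    charge-disjoint {u} {v} (right pu) (left pv) s t eq =
      sym (left-right-private-unique pv pu (charge-covered v (left pv) t) (subst (Covers u) eq (charge-covered u (right pu) s))
        (≤-trans (m≤m+n (c u) (toℕ s)) (≤-trans (≤-reflexive eq) (charge-left≤c (Fin-positive t) t))))

    sum-radii≤pred : ∀ {L} → (∀ u → 0 < r u → hi u ≤ L) → (∀ u → 0 < r u → PrivateBoundary u) →
                     sum (tabulate r) ≤ pred L
    sum-radii≤pred {L} hi≤L boundary = sum-≤-of-disjoint-injections r index index-injective index-disjoint
      where
      boundaryAt : ∀ u → Fin (r u) → PrivateBoundary u
      boundaryAt u t = boundary u (Fin-positive t)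

      point : ∀ u → Fin (r u) → ℕ
      point u t = charge u (boundaryAt u t) t

      point<L : ∀ u t → point u t < L
      point<L u t = <-≤-trans (charge<hi u (boundaryAt u t) t) (hi≤L u (Fin-positive t))

      index : ∀ u → Fin (r u) → Fin (pred L)
      index u t = fromℕ< (pred-mono-< {{>-nonZero (charge-positive u (boundaryAt u t) t)}} (point<L u t))

      point-injective : ∀ {u v s t} → index u s ≡ index v t → point u s ≡ point v t
      point-injective {u} {v} {s} {t} eq =
        pred-injective {{>-nonZero (charge-positive u (boundaryAt u s) s)}} {{>-nonZero (charge-positive v (boundaryAt v t) t)}} (begin
        pred (point u s)    ≡⟨ toℕ-fromℕ< _ ⟨
        toℕ (index u s)     ≡⟨ cong toℕ eq ⟩
        toℕ (index v t)     ≡⟨ toℕ-fromℕ< _ ⟩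
        pred (point v t)    ∎)
        where open ≡-Reasoning

      index-injective : ∀ u → Injective _≡_ _≡_ (index u)
      index-injective u {s} {t} eq = charge-injective u (boundaryAt u s) (begin
        charge u (boundaryAt u s) s   ≡⟨ point-injective eq ⟩
        charge u (boundaryAt u t) t   ≡⟨ cong (λ b → charge u (boundary u b) t) (<-irrelevant _ _) ⟩
        charge u (boundaryAt u s) t   ∎)
        where open ≡-Reasoning

      index-disjoint : ∀ {u v s t} → index u s ≡ index v t → u ≡ v
      index-disjoint {u} {v} {s} {t} eq = charge-disjoint (boundaryAt u s) (boundaryAt v t) s t (point-injective eq)

[m%n+o]%n≡[m+o]%n : ∀ m o n .{{_ : NonZero n}} → (m % n + o) % n ≡ (m + o) % n
[m%n+o]%n≡[m+o]%n m o n = begin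
  (m % n + o) % n            ≡⟨ %-distribˡ-+ (m % n) o n ⟩
  (m % n % n + o % n) % n    ≡⟨ cong (λ x → (x + o % n) % n) (m%n%n≡m%n m n) ⟩
  (m % n + o % n) % n        ≡⟨ %-distribˡ-+ m o n ⟨
  (m + o) % n                ∎
  where open ≡-Reasoning

-- Adding (pred n) · o, a multiple of n minus o, undoes the addition of o.
%-cancelʳ-+ : ∀ n .{{_ : NonZero n}} a b o → (a + o) % n ≡ (b + o) % n → a % n ≡ b % n
%-cancelʳ-+ n@(suc N) a b o eq = begin
  a % n                      ≡⟨ [m+kn]%n≡m%n a o n ⟨
  (a + o * n) % n            ≡⟨ cong (_% n) (shift a) ⟩
  ((a + o) + N * o) % n      ≡⟨ [m%n+o]%n≡[m+o]%n (a + o) (N * o) n ⟨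
  ((a + o) % n + N * o) % n  ≡⟨ cong (λ x → (x + N * o) % n) eq ⟩
  ((b + o) % n + N * o) % n  ≡⟨ [m%n+o]%n≡[m+o]%n (b + o) (N * o) n ⟩
  ((b + o) + N * o) % n      ≡⟨ cong (_% n) (shift b) ⟨
  (b + o * n) % n            ≡⟨ [m+kn]%n≡m%n b o n ⟩
  b % n                      ∎
  where
  open ≡-Reasoning
  shift : ∀ x → x + o * n ≡ (x + o) + N * o
  shift x = trans (cong (x +_) (*-comm o n)) (sym (+-assoc x o (N * o)))

%-wrap : ∀ {n} .{{_ : NonZero n}} {a b} → a < n → b < n → (a + b) % n ≡ a + b ⊎ (a + b) % n + n ≡ a + b
%-wrap {n} {a} {b} a<n b<n with ≤-<-connex n (a + b)
... | inj₂ a+b<n = inj₁ (m<n⇒m%n≡m a+b<n)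
... | inj₁ n≤a+b = inj₂ (begin
  (a + b) % n + n            ≡⟨ cong (λ x → x % n + n) (m∸n+n≡m n≤a+b) ⟨
  (a + b ∸ n + n) % n + n    ≡⟨ cong (_+ n) ([m+n]%n≡m%n (a + b ∸ n) n) ⟩
  (a + b ∸ n) % n + n        ≡⟨ cong (_+ n) (m<n⇒m%n≡m (m<n+o⇒m∸n<o (a + b) n (+-mono-< a<n b<n))) ⟩
  a + b ∸ n + n              ≡⟨ m∸n+n≡m n≤a+b ⟩
  a + b                      ∎)
  where open ≡-Reasoning

m<n+o⇒m≤n+pred[o] : ∀ {m} n o .{{_ : NonZero o}} → m < n + o → m ≤ n + pred o
m<n+o⇒m≤n+pred[o] {m} n (suc o) lt = ≤-pred (subst (m <_) (+-suc n o) lt)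

module _ {n} {G : Graph n} where

  within-mono : ∀ {j k x y} → j ≤ k → Within G j x y → Within G k x y
  within-mono _         here       = here
  within-mono (s≤s j≤k) (step a w) = step a (within-mono j≤k w)

  within-snoc : ∀ {k x w y} → Within G k x w → Adj G w y → Within G (suc k) x y
  within-snoc here       a′ = step a′ here
  within-snoc (step a w) a′ = step a (within-snoc w a′)

  within-sym : (∀ {u v} → Adj G u v → Adj G v u) → ∀ {k x y} → Within G k x y → Within G k y x
  within-sym adj-sym here       = here
  within-sym adj-sym (step a w) = within-snoc (within-sym adj-sym w) (adj-sym a)

module _ {n : ℕ} .{{_ : NonZero n}} where

  cycle-adj-sym : ∀ {u v} → Adj (Cycle n) u v → Adj (Cycle n) v u
  cycle-adj-sym = swap

  toℕ-cycSuc : ∀ x → toℕ (cycSuc n x) ≡ (toℕ x + 1) % n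
  toℕ-cycSuc x = toℕ-fromℕ< _

  cycSuc-injective : Injective _≡_ _≡_ (cycSuc n)
  cycSuc-injective {x} {y} eq = toℕ-injective (begin
    toℕ x          ≡⟨ m<n⇒m%n≡m (toℕ<n x) ⟨
    toℕ x % n      ≡⟨ %-cancelʳ-+ n (toℕ x) (toℕ y) 1 (trans (sym (toℕ-cycSuc x)) (trans (cong toℕ eq) (toℕ-cycSuc y))) ⟩
    toℕ y % n      ≡⟨ m<n⇒m%n≡m (toℕ<n y) ⟩
    toℕ y          ∎)
    where open ≡-Reasoning

  cycSuc-cycPred : ∀ x → cycSuc n (cycPred n x) ≡ x
  cycSuc-cycPred x = toℕ-injective (begin
    toℕ (cycSuc n (cycPred n x))        ≡⟨ toℕ-cycSuc (cycPred n x) ⟩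
    (toℕ (cycPred n x) + 1) % n         ≡⟨ cong (λ y → (y + 1) % n) (toℕ-fromℕ< _) ⟩
    ((toℕ x + (n ∸ 1)) % n + 1) % n     ≡⟨ [m%n+o]%n≡[m+o]%n (toℕ x + (n ∸ 1)) 1 n ⟩
    (toℕ x + (n ∸ 1) + 1) % n           ≡⟨ cong (_% n) (+-assoc (toℕ x) (n ∸ 1) 1) ⟩
    (toℕ x + (n ∸ 1 + 1)) % n           ≡⟨ cong (λ y → (toℕ x + y) % n) (m∸n+n≡m (>-nonZero⁻¹ n)) ⟩
    (toℕ x + n) % n                     ≡⟨ [m+n]%n≡m%n (toℕ x) n ⟩
    toℕ x % n                           ≡⟨ m<n⇒m%n≡m (toℕ<n x) ⟩
    toℕ x                               ∎)
    where open ≡-Reasoning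

  advance : Fin n → ℕ → Fin n
  advance x zero    = x
  advance x (suc j) = advance (cycSuc n x) j

  advance-suc : ∀ x j → advance x (suc j) ≡ cycSuc n (advance x j)
  advance-suc x zero    = refl
  advance-suc x (suc j) = advance-suc (cycSuc n x) j

  within-advance : ∀ x j → Within (Cycle n) j x (advance x j)
  within-advance x zero    = here
  within-advance x (suc j) = step (inj₁ refl) (within-advance (cycSuc n x) j)

  within⇒advance : ∀ {k x y} → Within (Cycle n) k x y →
                   ∃ λ j → j ≤ k × (advance x j ≡ y ⊎ advance y j ≡ x)
  within⇒advance here = 0 , z≤n , inj₁ refl
  within⇒advance (step (inj₁ refl) w) with within⇒advance w
  ... | j     , j≤k , inj₁ fwd = suc j , s≤s j≤k , inj₁ fwd
  ... | zero  , _   , inj₂ refl = 1 , s≤s z≤n , inj₁ refl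
  ... | suc j , j≤k , inj₂ bwd =
    j , m≤n⇒m≤1+n (≤-trans (n≤1+n j) j≤k) , inj₂ (cycSuc-injective (trans (sym (advance-suc _ j)) bwd))
  within⇒advance (step (inj₂ refl) w) with within⇒advance w
  ... | zero  , _   , inj₁ refl = 1 , s≤s z≤n , inj₂ refl
  ... | suc j , j≤k , inj₁ fwd = j , m≤n⇒m≤1+n (≤-trans (n≤1+n j) j≤k) , inj₁ fwd
  ... | j     , j≤k , inj₂ bwd = suc j , s≤s j≤k , inj₂ (trans (advance-suc _ j) (cong (cycSuc n) bwd))

module Coordinates (n : ℕ) .{{_ : NonZero n}} (T : ℕ) where

  ρ : Fin n → ℕ
  ρ x = (toℕ x + T) % n

  ρ<n : ∀ x → ρ x < n
  ρ<n x = m%n<n (toℕ x + T) n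

  ρ-injective : Injective _≡_ _≡_ ρ
  ρ-injective {x} {y} eq = toℕ-injective (begin
    toℕ x       ≡⟨ m<n⇒m%n≡m (toℕ<n x) ⟨
    toℕ x % n   ≡⟨ %-cancelʳ-+ n (toℕ x) (toℕ y) T eq ⟩
    toℕ y % n   ≡⟨ m<n⇒m%n≡m (toℕ<n y) ⟩
    toℕ y       ∎)
    where open ≡-Reasoning

  ρ-fromℕ< : ∀ {p} (p<n : p < n) → ρ (fromℕ< p<n) ≡ (p + T) % n
  ρ-fromℕ< p<n = cong (λ x → (x + T) % n) (toℕ-fromℕ< p<n)

  ρ-cycSuc : ∀ x → ρ (cycSuc n x) ≡ (ρ x + 1) % n
  ρ-cycSuc x = begin
    (toℕ (cycSuc n x) + T) % n     ≡⟨ cong (λ y → (y + T) % n) (toℕ-cycSuc x) ⟩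
    ((toℕ x + 1) % n + T) % n      ≡⟨ [m%n+o]%n≡[m+o]%n (toℕ x + 1) T n ⟩
    (toℕ x + 1 + T) % n            ≡⟨ cong (_% n) (+-assoc (toℕ x) 1 T) ⟩
    (toℕ x + (1 + T)) % n          ≡⟨ cong (λ y → (toℕ x + y) % n) (+-comm 1 T) ⟩
    (toℕ x + (T + 1)) % n          ≡⟨ cong (_% n) (+-assoc (toℕ x) T 1) ⟨
    (toℕ x + T + 1) % n            ≡⟨ [m%n+o]%n≡[m+o]%n (toℕ x + T) 1 n ⟨
    (ρ x + 1) % n                  ∎
    where open ≡-Reasoning

  ρ-advance : ∀ x j → ρ (advance x j) ≡ (ρ x + j) % n
  ρ-advance x zero = begin
    ρ x              ≡⟨ m%n%n≡m%n (toℕ x + T) n ⟨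
    ρ x % n          ≡⟨ cong (_% n) (+-identityʳ (ρ x)) ⟨
    (ρ x + 0) % n    ∎
    where open ≡-Reasoning
  ρ-advance x (suc j) = begin
    ρ (advance (cycSuc n x) j)        ≡⟨ ρ-advance (cycSuc n x) j ⟩
    (ρ (cycSuc n x) + j) % n          ≡⟨ cong (λ y → (y + j) % n) (ρ-cycSuc x) ⟩
    ((ρ x + 1) % n + j) % n           ≡⟨ [m%n+o]%n≡[m+o]%n (ρ x + 1) j n ⟩
    (ρ x + 1 + j) % n                 ≡⟨ cong (_% n) (+-assoc (ρ x) 1 j) ⟩
    (ρ x + suc j) % n                 ∎
    where open ≡-Reasoning

  ahead⇒within : ∀ {k x y} → ρ x ≤ ρ y → ρ y ≤ ρ x + k → Within (Cycle n) k x y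
  ahead⇒within {k} {x} {y} x≤y y≤x+k =
    within-mono (m≤n+o⇒m∸n≤o (ρ y) (ρ x) y≤x+k) (subst (Within (Cycle n) _ x) lands (within-advance x (ρ y ∸ ρ x)))
    where
    lands : advance x (ρ y ∸ ρ x) ≡ y
    lands = ρ-injective (begin
      ρ (advance x (ρ y ∸ ρ x))   ≡⟨ ρ-advance x (ρ y ∸ ρ x) ⟩
      (ρ x + (ρ y ∸ ρ x)) % n     ≡⟨ cong (_% n) (m+[n∸m]≡n x≤y) ⟩
      ρ y % n                     ≡⟨ m<n⇒m%n≡m (ρ<n y) ⟩
      ρ y                         ∎)
      where open ≡-Reasoning

  close⇒within : ∀ {k x y} → ρ y ≤ ρ x + k → ρ x ≤ ρ y + k → Within (Cycle n) k x y
  close⇒within {k} {x} {y} y≤x+k x≤y+k with ≤-total (ρ x) (ρ y)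
  ... | inj₁ x≤y = ahead⇒within x≤y y≤x+k
  ... | inj₂ y≤x = within-sym cycle-adj-sym (ahead⇒within y≤x x≤y+k)

  -- A walk of length k ≤ ρ y ending at y cannot wrap around position 0.
  within⇒close : ∀ {k x y} → k ≤ ρ y → ρ y + k < n → Within (Cycle n) k x y → ρ x ≤ ρ y + k × ρ y ≤ ρ x + k
  within⇒close {k} {x} {y} k≤y y+k<n w with within⇒advance w
  ... | j , j≤k , inj₂ y→x = ≤-trans (≤-reflexive x≡y+j) (+-monoʳ-≤ (ρ y) j≤k) ,
                             ≤-trans (m≤m+n (ρ y) j) (≤-trans (≤-reflexive (sym x≡y+j)) (m≤m+n (ρ x) k))
    where
    x≡y+j : ρ x ≡ ρ y + j
    x≡y+j = trans (sym (cong ρ y→x)) (trans (ρ-advance y j) (m<n⇒m%n≡m (≤-<-trans (+-monoʳ-≤ (ρ y) j≤k) y+k<n)))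
  ... | j , j≤k , inj₁ x→y with %-wrap (ρ<n x) (≤-<-trans j≤k (≤-<-trans k≤y (ρ<n y)))
  ...   | inj₁ no-wrap = ≤-trans (m≤m+n (ρ x) j) (≤-trans (≤-reflexive (sym y≡x+j)) (m≤m+n (ρ y) k)) ,
                        ≤-trans (≤-reflexive y≡x+j) (+-monoʳ-≤ (ρ x) j≤k)
    where
    y≡x+j : ρ y ≡ ρ x + j
    y≡x+j = trans (sym (cong ρ x→y)) (trans (ρ-advance x j) no-wrap)
  ...   | inj₂ wrap = ⊥-elim (<⇒≱ (+-cancelʳ-< n (ρ y) j y+n<j+n) (≤-trans j≤k k≤y))
    where
    y+n<j+n : ρ y + n < j + n
    y+n<j+n = begin-strict
      ρ y + n                 ≡⟨ cong (_+ n) (trans (sym (cong ρ x→y)) (ρ-advance x j)) ⟩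
      (ρ x + j) % n + n       ≡⟨ wrap ⟩
      ρ x + j                 <⟨ +-monoˡ-< j (ρ<n x) ⟩
      n + j                   ≡⟨ +-comm n j ⟩
      j + n                   ∎
      where open ≤-Reasoning

  module Linear (g : Fin n → ℕ) (fits : ∀ w → 0 < g w → g w ≤ ρ w × ρ w + g w < n) where

    open Intervals ρ g public

    private
      radius≤centre : ∀ w → 0 < g w → g w ≤ ρ w
      radius≤centre w gw = proj₁ (fits w gw)

      hi<n : ∀ w → 0 < g w → hi w < n
      hi<n w gw = proj₂ (fits w gw)

    hears⇒covers : ∀ {y w} → Hears (Cycle n) g y w → Covers w (ρ y)
    hears⇒covers {y} {w} (gw , within) with within⇒close (radius≤centre w gw) (hi<n w gw) within
    ... | y≤hi , c≤y+g = gw , m≤n+o⇒m∸n≤o (ρ w) (g w) (subst (ρ w ≤_) (+-comm (ρ y) (g w)) c≤y+g) , y≤hi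

    covers⇒hears : ∀ {y w} → Covers w (ρ y) → Hears (Cycle n) g y w
    covers⇒hears {y} {w} (gw , lo≤y , y≤hi) =
      gw , close⇒within (≤-trans (m≤n+m∸n (ρ w) (g w)) (subst (_≤ ρ y + g w) (+-comm (lo w) (g w)) (+-monoˡ-≤ (g w) lo≤y))) y≤hi

    at-distance⇒endpoint : ∀ {e w} → 0 < g w → DistEq (Cycle n) e w (g w) → ρ e ≡ lo w ⊎ ρ e ≡ hi w
    at-distance⇒endpoint {e} {w} gw (within , shortest) with hears⇒covers (gw , within)
    ... | _ , lo≤e , e≤hi with m≤n⇒m<n∨m≡n lo≤e | m≤n⇒m<n∨m≡n e≤hi
    ...   | inj₂ lo≡e | _          = inj₁ (sym lo≡e)
    ...   | inj₁ _    | inj₂ e≡hi  = inj₂ e≡hi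
    ...   | inj₁ lo<e | inj₁ e<hi  = ⊥-elim (shortest (pred (g w)) (≤-reflexive (suc-pred (g w))) closer)
      where
      instance
        g≢0 : NonZero (g w)
        g≢0 = >-nonZero gw

      w<e+g : ρ w < ρ e + g w
      w<e+g = subst (_< ρ e + g w) (lo+r≡c radius≤centre gw) (+-monoˡ-< (g w) lo<e)

      closer : Within (Cycle n) (pred (g w)) e w
      closer = close⇒within (m<n+o⇒m≤n+pred[o] (ρ e) (g w) w<e+g) (m<n+o⇒m≤n+pred[o] (ρ w) (g w) e<hi)

    endpoint⇒at-distance : ∀ {e w} → 0 < g w → ρ e ≡ lo w ⊎ ρ e ≡ hi w → DistEq (Cycle n) e w (g w)
    endpoint⇒at-distance {e} {w} gw endpoint = proj₂ (covers⇒hears (covers endpoint)) , shortest endpoint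
      where
      lo≤hi : lo w ≤ hi w
      lo≤hi = ≤-trans (m∸n≤m (ρ w) (g w)) (m≤m+n (ρ w) (g w))

      covers : ρ e ≡ lo w ⊎ ρ e ≡ hi w → Covers w (ρ e)
      covers (inj₁ e≡lo) = gw , ≤-reflexive (sym e≡lo) , subst (_≤ hi w) (sym e≡lo) lo≤hi
      covers (inj₂ e≡hi) = gw , subst (lo w ≤_) (sym e≡hi) lo≤hi , ≤-reflexive e≡hi

      shortest : ρ e ≡ lo w ⊎ ρ e ≡ hi w → ∀ j → j < g w → ¬ Within (Cycle n) j e w
      shortest endpoint j j<g within
        with within⇒close (<⇒≤ (<-≤-trans j<g (radius≤centre w gw)))
                          (≤-<-trans (+-monoʳ-≤ (ρ w) (<⇒≤ j<g)) (hi<n w gw)) within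
      shortest (inj₁ e≡lo) j j<g _ | _ , w≤e+j =
        <-irrefl refl (≤-<-trans w≤e+j (subst (λ c → ρ e + j < c) (trans (cong (_+ g w) e≡lo) (lo+r≡c radius≤centre gw))
                                              (+-monoʳ-< (ρ e) j<g)))
      shortest (inj₂ e≡hi) j j<g _ | e≤w+j , _ =
        <-irrefl refl (≤-<-trans e≤w+j (subst (ρ w + j <_) (sym e≡hi) (+-monoʳ-< (ρ w) j<g)))

    privateBoundary : ∀ {w} → 0 < g w → PBNonempty (Cycle n) g w → PrivateBoundary w
    privateBoundary {w} gw (inj₁ (g≡1 , own)) =
      centre g≡1 λ v cov → proj₂ (proj₂ (own w) refl) v (covers⇒hears cov)
    privateBoundary {w} gw (inj₂ (e , (_ , unique) , at-distance)) with at-distance⇒endpoint gw at-distance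
    ... | inj₁ e≡lo = left  (subst (λ p → Private p w) e≡lo λ v cov → unique v (covers⇒hears cov))
    ... | inj₂ e≡hi = right (subst (λ p → Private p w) e≡hi λ v cov → unique v (covers⇒hears cov))

    irredundant-from-private-endpoints :
      (∀ w → 0 < g w → ∃ λ e → (ρ e ≡ lo w ⊎ ρ e ≡ hi w) × Private (ρ e) w) → Irredundant (Cycle n) g
    irredundant-from-private-endpoints endpoints = broadcast , boundary
      where
      broadcast : IsBroadcast (Cycle n) g
      broadcast w with 0 <? g w
      ... | yes gw = let (e , endpoint , _) = endpoints w gw in
                     e , λ j j<g within → proj₂ (endpoint⇒at-distance gw endpoint) j j<g (within-sym cycle-adj-sym within)
      ... | no g≯0 = w , λ j j<g _ → g≯0 (≤-<-trans z≤n j<g)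

      boundary : ∀ w → 0 < g w → PBNonempty (Cycle n) g w
      boundary w gw with endpoints w gw
      ... | e , endpoint , priv = inj₂ (e , ((gw , proj₁ at-distance) , λ v hears → priv v (hears⇒covers hears)) , at-distance)
        where at-distance = endpoint⇒at-distance gw endpoint

broadcaster≢silent : ∀ {n} {G : Graph n} (f : Fin n → ℕ) {u x} → 0 < f u → HearsNothing G f x → u ≢ x
broadcaster≢silent f fu silent refl = silent _ (fu , here)

cost≡sum-tabulate : ∀ {n} (f : Fin n → ℕ) → cost f ≡ sum (tabulate f)
cost≡sum-tabulate f = cong sum (map-tabulate (λ x → x) f)

module SilentPair (K : ℕ) (f : Fin (3 + K) → ℕ) (a : Fin (3 + K))
                  (silent-a : HearsNothing (Cycle (3 + K)) f a)
                  (silent-b : HearsNothing (Cycle (3 + K)) f (cycSuc (3 + K) a)) where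

  n : ℕ
  n = 3 + K

  b : Fin n
  b = cycSuc n a

  open Coordinates n (n ∸ toℕ a + suc K)

  ρa : ρ a ≡ suc K
  ρa = begin
    (toℕ a + (n ∸ toℕ a + suc K)) % n    ≡⟨ cong (_% n) (+-assoc (toℕ a) (n ∸ toℕ a) (suc K)) ⟨
    (toℕ a + (n ∸ toℕ a) + suc K) % n    ≡⟨ cong (λ x → (x + suc K) % n) (m+[n∸m]≡n (toℕ≤n a)) ⟩
    (n + suc K) % n                      ≡⟨ cong (_% n) (+-comm n (suc K)) ⟩
    (suc K + n) % n                      ≡⟨ [m+n]%n≡m%n (suc K) n ⟩
    suc K % n                            ≡⟨ m<n⇒m%n≡m (s≤s (s≤s (n≤1+n K))) ⟩
    suc K                                ∎
    where open ≡-Reasoning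

  ρb : ρ b ≡ suc (suc K)
  ρb = begin
    ρ (cycSuc n a)      ≡⟨ ρ-cycSuc a ⟩
    (ρ a + 1) % n       ≡⟨ cong (λ x → (x + 1) % n) ρa ⟩
    (suc K + 1) % n     ≡⟨ cong (_% n) (+-comm (suc K) 1) ⟩
    suc (suc K) % n     ≡⟨ m<n⇒m%n≡m ≤-refl ⟩
    suc (suc K)         ∎
    where open ≡-Reasoning

  centre≤K : ∀ u → 0 < f u → ρ u ≤ K
  centre≤K u fu with m≤n⇒m<n∨m≡n (≤-pred (ρ<n u))
  ... | inj₂ u≡b = ⊥-elim (broadcaster≢silent f fu silent-b (ρ-injective (trans u≡b (sym ρb))))
  ... | inj₁ u≤a with m≤n⇒m<n∨m≡n (≤-pred u≤a)
  ...   | inj₂ u≡a = ⊥-elim (broadcaster≢silent f fu silent-a (ρ-injective (trans u≡a (sym ρa))))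
  ...   | inj₁ u<a = ≤-pred u<a

  hi≤K : ∀ u → 0 < f u → ρ u + f u ≤ K
  hi≤K u fu with ≤-<-connex (ρ u + f u) K
  ... | inj₁ hi≤K = hi≤K
  ... | inj₂ K<hi = ⊥-elim (silent-a u (fu , close⇒within u≤a+f (subst (_≤ ρ u + f u) (sym ρa) K<hi)))
    where
    u≤a+f : ρ u ≤ ρ a + f u
    u≤a+f = ≤-trans (n≤1+n (ρ u)) (≤-trans (s≤s (centre≤K u fu)) (subst (_≤ ρ a + f u) ρa (m≤m+n (ρ a) (f u))))

  -- Walking forward from b for ρ u + 1 steps passes position 0 and reaches u.
  radius≤centre : ∀ u → 0 < f u → f u ≤ ρ u
  radius≤centre u fu with ≤-<-connex (f u) (ρ u)
  ... | inj₁ f≤ρ = f≤ρ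
  ... | inj₂ ρ<f = ⊥-elim (silent-b u (fu , within-mono ρ<f (subst (Within (Cycle n) _ b) lands (within-advance b (suc (ρ u))))))
    where
    lands : advance b (suc (ρ u)) ≡ u
    lands = ρ-injective (begin
      ρ (advance b (suc (ρ u)))     ≡⟨ ρ-advance b (suc (ρ u)) ⟩
      (ρ b + suc (ρ u)) % n         ≡⟨ cong (λ x → (x + suc (ρ u)) % n) ρb ⟩
      (suc (suc K) + suc (ρ u)) % n ≡⟨ cong (_% n) (trans (+-suc (suc (suc K)) (ρ u)) (+-comm n (ρ u))) ⟩
      (ρ u + n) % n                 ≡⟨ [m+n]%n≡m%n (ρ u) n ⟩
      ρ u % n                       ≡⟨ m<n⇒m%n≡m (ρ<n u) ⟩
      ρ u                           ∎)
      where open ≡-Reasoning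

  fits : ∀ u → 0 < f u → f u ≤ ρ u × ρ u + f u < n
  fits u fu = radius≤centre u fu , ≤-<-trans (hi≤K u fu) (m<n+m K {3} (s≤s z≤n))

  open Linear f fits

  cost≤pred[K] : Irredundant (Cycle n) f → cost f ≤ pred K
  cost≤pred[K] (_ , pb) = begin
    cost f              ≡⟨ cost≡sum-tabulate f ⟩
    sum (tabulate f)    ≤⟨ sum-radii≤pred radius≤centre hi≤K (λ u fu → privateBoundary fu (pb u fu)) ⟩
    pred K              ∎
    where open ≤-Reasoning

module Solo (N r : ℕ) (r+r<n : r + r < suc N) where

  n : ℕ
  n = suc N

  open Coordinates n r

  g : Fin n → ℕ
  g Fin.zero    = r
  g (Fin.suc _) = 0

  ρ-zero : ρ Fin.zero ≡ r
  ρ-zero = m<n⇒m%n≡m (≤-<-trans (m≤m+n r r) r+r<n)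

  fits : ∀ w → 0 < g w → g w ≤ ρ w × ρ w + g w < n
  fits Fin.zero _ = ≤-reflexive (sym ρ-zero) , subst (λ c → c + r < n) (sym ρ-zero) r+r<n

  open Linear g fits

  r<n : r < n
  r<n = ≤-<-trans (m≤m+n r r) r+r<n

  ρ-far : ρ (fromℕ< r<n) ≡ hi Fin.zero
  ρ-far = trans (ρ-fromℕ< r<n) (trans (m<n⇒m%n≡m r+r<n) (cong (_+ r) (sym ρ-zero)))

  private-far : Private (ρ (fromℕ< r<n)) Fin.zero
  private-far Fin.zero    _       = refl
  private-far (Fin.suc _) (() , _)

  irredundant : Irredundant (Cycle n) g
  irredundant = irredundant-from-private-endpoints endpoints
    where
    endpoints : ∀ w → 0 < g w → ∃ λ e → (ρ e ≡ lo w ⊎ ρ e ≡ hi w) × Private (ρ e) w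
    endpoints Fin.zero _ = fromℕ< r<n , inj₂ ρ-far , private-far

  r≤cost : r ≤ cost g
  r≤cost = subst (r ≤_) (sym (cost≡sum-tabulate g)) (m≤m+n r _)

module Twin (N r : ℕ) (2r+1<n : suc (r + r) < suc (suc N)) where

  n : ℕ
  n = suc (suc N)

  open Coordinates n r

  g : Fin n → ℕ
  g Fin.zero              = r
  g (Fin.suc Fin.zero)    = r
  g (Fin.suc (Fin.suc _)) = 0

  r≤n : r ≤ n
  r≤n = ≤-trans (m≤m+n r r) (≤-trans (n≤1+n _) (<⇒≤ 2r+1<n))

  1+r<n : suc r < n
  1+r<n = ≤-<-trans (s≤s (m≤m+n r r)) 2r+1<n

  ρ-zero : ρ Fin.zero ≡ r
  ρ-zero = m<n⇒m%n≡m (<-trans (n<1+n r) 1+r<n)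

  ρ-one : ρ (Fin.suc Fin.zero) ≡ suc r
  ρ-one = m<n⇒m%n≡m 1+r<n

  fits : ∀ w → 0 < g w → g w ≤ ρ w × ρ w + g w < n
  fits Fin.zero           _ = ≤-reflexive (sym ρ-zero) , subst (λ c → c + r < n) (sym ρ-zero) (<-trans (n<1+n _) 2r+1<n)
  fits (Fin.suc Fin.zero) _ = subst (r ≤_) (sym ρ-one) (n≤1+n r) , subst (λ c → c + r < n) (sym ρ-one) 2r+1<n

  open Linear g fits

  -- The private boundary points of vertices 0 and 1 are at positions 0 and 2r + 1.
  antipode : 0 < r → Fin n
  antipode 0<r = fromℕ< (∸-monoʳ-< 0<r r≤n)

  ρ-antipode : ∀ 0<r → ρ (antipode 0<r) ≡ 0
  ρ-antipode 0<r = begin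
    ρ (antipode 0<r)        ≡⟨ ρ-fromℕ< (∸-monoʳ-< 0<r r≤n) ⟩
    (n ∸ r + r) % n         ≡⟨ cong (_% n) (m∸n+n≡m r≤n) ⟩
    n % n                   ≡⟨ n%n≡0 n ⟩
    0                       ∎
    where open ≡-Reasoning

  ρ-far : ρ (fromℕ< 1+r<n) ≡ suc (r + r)
  ρ-far = trans (ρ-fromℕ< 1+r<n) (m<n⇒m%n≡m 2r+1<n)

  lo-zero : lo Fin.zero ≡ 0
  lo-zero = trans (cong (_∸ r) ρ-zero) (n∸n≡0 r)

  lo-one : lo (Fin.suc Fin.zero) ≡ 1
  lo-one = trans (cong (_∸ r) ρ-one) (m+n∸n≡m 1 r)

  private-antipode : ∀ 0<r → Private (ρ (antipode 0<r)) Fin.zero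
  private-antipode 0<r Fin.zero              _            = refl
  private-antipode 0<r (Fin.suc Fin.zero)    (_ , lo≤ , _) = ⊥-elim (1+n≰n (subst₂ _≤_ lo-one (ρ-antipode 0<r) lo≤))
  private-antipode 0<r (Fin.suc (Fin.suc _)) (() , _)

  private-far : Private (ρ (fromℕ< 1+r<n)) (Fin.suc Fin.zero)
  private-far Fin.zero              (_ , _ , ≤hi) = ⊥-elim (1+n≰n (subst₂ _≤_ ρ-far (cong (_+ r) ρ-zero) ≤hi))
  private-far (Fin.suc Fin.zero)    _            = refl
  private-far (Fin.suc (Fin.suc _)) (() , _)

  irredundant : Irredundant (Cycle n) g
  irredundant = irredundant-from-private-endpoints endpoints
    where
    endpoints : ∀ w → 0 < g w → ∃ λ e → (ρ e ≡ lo w ⊎ ρ e ≡ hi w) × Private (ρ e) w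
    endpoints Fin.zero           0<r = antipode 0<r , inj₁ (trans (ρ-antipode 0<r) (sym lo-zero)) , private-antipode 0<r
    endpoints (Fin.suc Fin.zero) _   = fromℕ< 1+r<n , inj₂ (trans ρ-far (cong (_+ r) (sym ρ-one))) , private-far

  r+r≤cost : r + r ≤ cost g
  r+r≤cost = subst (r + r ≤_) (sym (cost≡sum-tabulate g)) (+-monoʳ-≤ r (m≤m+n r _))

n≤⌈n/2⌉+⌈n/2⌉ : ∀ n → n ≤ ⌈ n /2⌉ + ⌈ n /2⌉
n≤⌈n/2⌉+⌈n/2⌉ n = subst (_≤ ⌈ n /2⌉ + ⌈ n /2⌉) (⌊n/2⌋+⌈n/2⌉≡n n) (+-monoˡ-≤ ⌈ n /2⌉ (⌊n/2⌋≤⌈n/2⌉ n))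

⌈n/2⌉+⌈n/2⌉≤1+n : ∀ n → ⌈ n /2⌉ + ⌈ n /2⌉ ≤ suc n
⌈n/2⌉+⌈n/2⌉≤1+n n = subst (⌈ n /2⌉ + ⌈ n /2⌉ ≤_) (⌊n/2⌋+⌈n/2⌉≡n (suc n)) (+-monoʳ-≤ ⌈ n /2⌉ (⌊n/2⌋≤⌈n/2⌉ (suc n)))

competitor : ∀ K → ∃ λ g → Irredundant (Cycle (3 + K)) g × pred K < cost g
competitor zero    = Solo.g 2 1 ≤-refl , Solo.irredundant 2 1 ≤-refl , Solo.r≤cost 2 1 ≤-refl
competitor (suc K) = Twin.g _ r 2r+1<n , Twin.irredundant _ r 2r+1<n ,
                     <-≤-trans (n≤⌈n/2⌉+⌈n/2⌉ (suc K)) (Twin.r+r≤cost _ r 2r+1<n)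
  where
  r : ℕ
  r = ⌈ suc K /2⌉

  2r+1<n : suc (r + r) < 4 + K
  2r+1<n = s≤s (s≤s (⌈n/2⌉+⌈n/2⌉≤1+n (suc K)))

no-adjacent-silent-pair : ∀ K (f : Fin (3 + K) → ℕ) → IsIRbBroadcast (Cycle (3 + K)) f →
  ∀ a → HearsNothing (Cycle (3 + K)) f a → ¬ HearsNothing (Cycle (3 + K)) f (cycSuc (3 + K) a)
no-adjacent-silent-pair K f (irredundant , maximal) a silent-a silent-b with competitor K
... | g , g-irredundant , pred[K]<cost-g =
  <⇒≱ pred[K]<cost-g (≤-trans (maximal g g-irredundant) (SilentPair.cost≤pred[K] K f a silent-a silent-b irredundant))

lemma3p2 : (n : ℕ) .{{_ : NonZero n}} → 3 ≤ n →
    (f : Fin n → ℕ) → IsIRbBroadcast (Cycle n) f →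
    (i : Fin n) → HearsNothing (Cycle n) f i →
    ¬ HearsNothing (Cycle n) f (cycPred n i) × ¬ HearsNothing (Cycle n) f (cycSuc n i)
lemma3p2 (suc (suc (suc K))) (s≤s (s≤s (s≤s z≤n))) f maximal i silent-i =
  (λ silent-pred → no-adjacent-silent-pair K f maximal (cycPred _ i) silent-pred
                     (subst (HearsNothing (Cycle _) f) (sym (cycSuc-cycPred i)) silent-i)) ,
  no-adjacent-silent-pair K f maximal i silent-i
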